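{- Let $S\subseteq\mathbb N$ be a numerical semigroup with $S\neq\mathbb N$, with Frobenius number $f$, genus $g$, embedding dimension $e$ and multiplicity $m$. If $e\geq 2$, then $(e-1)(f+1-g)\geq m-1$.
   Context: $\mathbb N$ denotes the set of nonnegative integers. A numerical semigroup is a subset $S\subseteq\mathbb N$ that is closed under addition, contains $0$, and has only finitely many positive integers outside $S$; these are the gaps of $S$. The genus $g$ is the number of gaps, and the Frobenius number $f$ is the largest gap. With $S^*=S\setminus\{0\}$, the set $E=S^*\setminus(S^*+S^*)$ is the unique minimal generating set of $S$; its elements are the atoms, and their number $e$ is the embedding dimension. The smallest atom is the multiplicity $m$. -}

module Defs where

open import Data.Nat using (ℕ; zero; suc; _+_; _≤_; _<_; _≥_)
open import Data.Product using (Σ; ∃; _×_; _,_)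
open import Data.List using (List; length)
open import Data.List.Membership.Propositional using (_∈_)
open import Data.List.Relation.Unary.Unique.Propositional using (Unique)
open import Relation.Nullary using (¬_)
open import Function.Bundles using (_⇔_)
open import Relation.Binary.PropositionalEquality using (_≡_)

Subsetℕ : Set₁
Subsetℕ = ℕ → Set

-- Numerical semigroup: contains 0, closed under +, finitely many gaps
-- (equivalently: every sufficiently large integer is in S).
record IsNumericalSemigroup (S : Subsetℕ) : Set where
  field
    zero∈  : S 0
    closed : ∀ a b → S a → S b → S (a + b)
    cofinite : ∃ λ N → ∀ n → N ≤ n → S n

ProperSubset : Subsetℕ → Set
ProperSubset S = ∃ λ n → ¬ S n

IsGap : Subsetℕ → ℕ → Set
IsGap S x = (0 < x) × ¬ S x

InS* : Subsetℕ → ℕ → Set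
InS* S x = (0 < x) × S x

IsAtom : Subsetℕ → ℕ → Set
IsAtom S x = InS* S x × ¬ (∃ λ a → ∃ λ b → InS* S a × InS* S b × (x ≡ a + b))

IsFrobenius : Subsetℕ → ℕ → Set
IsFrobenius S f = IsGap S f × (∀ x → IsGap S x → x ≤ f)

IsGenus : Subsetℕ → ℕ → Set
IsGenus S g = Σ (List ℕ) λ L → Unique L × (∀ x → (x ∈ L) ⇔ IsGap S x) × (length L ≡ g)

IsEmbeddingDimension : Subsetℕ → ℕ → Set
IsEmbeddingDimension S e = Σ (List ℕ) λ L → Unique L × (∀ x → (x ∈ L) ⇔ IsAtom S x) × (length L ≡ e)

IsMultiplicity : Subsetℕ → ℕ → Set
IsMultiplicity S m = IsAtom S m × (∀ a → IsAtom S a → m ≤ a)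

-- The inequality is decidable, so we may argue classically and take membership in S to be
-- decidable. Write Ap(S, m) = {w ∈ S : w − m ∉ S} for the Apéry set of the multiplicity m.
-- Subtracting m from f + 1 + i (i < m) as long as the result stays in S gives m distinct elements
-- of Ap(S, m). A nonzero w ∈ Ap(S, m) splits as w = a + s with a an atom and s ∈ S; here a ≠ m
-- because w − m ∉ S, and s < w − m ≤ f because w − m is a gap. Hence Ap(S, m) ∖ {0} lies in the
-- sumset (E ∖ {m}) + (S ∩ [0, f]), which has at most (e − 1)(f + 1 − g) elements.
module Submission where

open import Defs
open import Data.Nat using (ℕ; zero; suc; _+_; _*_; _∸_; _≤_; _≥_; _<_; _≟_; _≤?_; _<?_; z≤n; s≤s; z<s)
open import Data.Nat.Properties
open import Data.Nat.Induction using (<-rec)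
open import Data.Product using (∃; ∃₂; _×_; _,_; proj₁; proj₂)
open import Data.Sum using (inj₁; inj₂)
open import Data.List using (List; []; _∷_; length; filter; upTo; cartesianProductWith; map; _++_)
open import Data.List.Properties using (filter-notAll; length-map; length-++; length-upTo)
open import Data.List.Membership.Propositional using (_∈_)
open import Data.List.Membership.Propositional.Properties
  using (∈-filter⁺; ∈-upTo⁺; ∈-upTo⁻; ∈-cartesianProductWith⁺)
open import Data.List.Relation.Unary.Any as Any using (here; there)
open import Data.List.Relation.Unary.All as All using ()
open import Data.List.Relation.Unary.AllPairs using (_∷_)
open import Data.List.Relation.Unary.Unique.Propositional using (Unique)
open import Data.List.Relation.Unary.Unique.Propositional.Properties using (upTo⁺)
open import Relation.Nullary using (¬_; Dec; yes; no; ¬?; contradiction)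
open import Relation.Nullary.Negation using (¬¬-map)
open import Relation.Nullary.Decidable using (_×-dec_; decidable-stable; ¬¬-excluded-middle)
open import Relation.Unary.Properties using (∁?)
open import Relation.Binary.Definitions using (DecidableEquality; tri<; tri≈; tri>)
open import Relation.Binary.PropositionalEquality
open import Function.Bundles using (Equivalence)

module _ {A B : Set} (_≟ᴮ_ : DecidableEquality B) where

  injection-length-≤ : (h : A → B) (xs : List A) (ys : List B) → Unique xs →
    (∀ {x y} → x ∈ xs → y ∈ xs → h x ≡ h y → x ≡ y) →
    (∀ {x} → x ∈ xs → h x ∈ ys) → length xs ≤ length ys
  injection-length-≤ h [] ys _ _ _ = z≤n
  injection-length-≤ h (x ∷ xs) ys (x∉xs ∷ unique) injective into = begin
    suc (length xs)     ≤⟨ s≤s (injection-length-≤ h xs ys′ unique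
                              (λ p q → injective (there p) (there q)) into′) ⟩
    suc (length ys′)    ≤⟨ filter-notAll other ys (Any.map (λ eq ne → ne (sym eq)) (into (here refl))) ⟩
    length ys           ∎
    where
    open ≤-Reasoning
    other : ∀ y → Dec (y ≢ h x)
    other y = ¬? (y ≟ᴮ h x)
    ys′ : List B
    ys′ = filter other ys
    into′ : ∀ {z} → z ∈ xs → h z ∈ ys′
    into′ z∈xs = ∈-filter⁺ other (into (there z∈xs))
      (λ hz≡hx → All.lookup x∉xs z∈xs (injective (here refl) (there z∈xs) (sym hz≡hx)))

length-cartesianProductWith : ∀ {A B C : Set} (f : A → B → C) xs ys →
  length (cartesianProductWith f xs ys) ≡ length xs * length ys
length-cartesianProductWith f [] ys = refl
length-cartesianProductWith f (x ∷ xs) ys = begin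
  length (map (f x) ys ++ cartesianProductWith f xs ys)
    ≡⟨ length-++ (map (f x) ys) ⟩
  length (map (f x) ys) + length (cartesianProductWith f xs ys)
    ≡⟨ cong₂ _+_ (length-map (f x) ys) (length-cartesianProductWith f xs ys) ⟩
  length ys + length xs * length ys ∎
  where open ≡-Reasoning

length-filter-+-length-filter-∁ : ∀ {A : Set} {P : A → Set} (P? : ∀ x → Dec (P x)) xs →
  length (filter P? xs) + length (filter (∁? P?) xs) ≡ length xs
length-filter-+-length-filter-∁ P? [] = refl
length-filter-+-length-filter-∁ P? (x ∷ xs) with P? x
... | yes _ = cong suc (length-filter-+-length-filter-∁ P? xs)
... | no _ = trans (+-suc _ _) (cong suc (length-filter-+-length-filter-∁ P? xs))

¬¬-decidable-below : (P : ℕ → Set) → ∀ N → ¬ ¬ (∀ n → n < N → Dec (P n))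
¬¬-decidable-below P zero k = k (λ _ ())
¬¬-decidable-below P (suc N) k =
  ¬¬-decidable-below P N λ below → ¬¬-excluded-middle λ P?N → k (extend below P?N)
  where
  extend : (∀ n → n < N → Dec (P n)) → Dec (P N) → ∀ n → n < suc N → Dec (P n)
  extend below P?N n n<1+N with m<1+n⇒m<n∨m≡n n<1+N
  ... | inj₁ n<N = below n n<N
  ... | inj₂ refl = P?N

¬¬-decidable-cofinite : (P : ℕ → Set) → (∃ λ N → ∀ n → N ≤ n → P n) → ¬ ¬ (∀ n → Dec (P n))
¬¬-decidable-cofinite P (N , above) = ¬¬-map decide (¬¬-decidable-below P N)
  where
  decide : (∀ n → n < N → Dec (P n)) → ∀ n → Dec (P n)
  decide below n with n <? N
  ... | yes n<N = below n n<N
  ... | no n≮N = yes (above n (≮⇒≥ n≮N))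

remainder-≥-of-quotient-< : ∀ {n c i i′ w j j′} → j < j′ →
  j * n + w ≡ c + i → j′ * n + w ≡ c + i′ → n ≤ i′
remainder-≥-of-quotient-< {n} {c} {i} {i′} {w} {j} {j′} j<j′ eq eq′ = +-cancelˡ-≤ c n i′ (begin
  c + n           ≤⟨ +-monoˡ-≤ n (m≤m+n c i) ⟩
  c + i + n       ≡⟨ +-comm (c + i) n ⟩
  n + (c + i)     ≡⟨ cong (n +_) (sym eq) ⟩
  n + (j * n + w) ≡⟨ sym (+-assoc n (j * n) w) ⟩
  suc j * n + w   ≤⟨ +-monoˡ-≤ w (*-monoˡ-≤ n j<j′) ⟩
  j′ * n + w      ≡⟨ eq′ ⟩
  c + i′          ∎)
  where open ≤-Reasoning

remainder-unique : ∀ {n c i i′ w j j′} → i < n → i′ < n →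
  j * n + w ≡ c + i → j′ * n + w ≡ c + i′ → i ≡ i′
remainder-unique {j = j} {j′} i<n i′<n eq eq′ with <-cmp j j′
... | tri< j<j′ _ _ = contradiction (remainder-≥-of-quotient-< j<j′ eq eq′) (<⇒≱ i′<n)
... | tri> _ _ j′<j = contradiction (remainder-≥-of-quotient-< j′<j eq′ eq) (<⇒≱ i<n)
... | tri≈ _ refl _ = +-cancelˡ-≡ _ _ _ (trans (sym eq) eq′)

module DecidableMembership (S : Subsetℕ) (ns : IsNumericalSemigroup S) (S? : ∀ n → Dec (S n)) where

  open IsNumericalSemigroup ns

  InS*? : ∀ n → Dec (InS* S n)
  InS*? n = 0 <? n ×-dec S? n

  atom-decomposition : ∀ w → InS* S w → ∃₂ λ a s → IsAtom S a × S s × w ≡ a + s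
  atom-decomposition = <-rec _ decompose
    where
    decompose : ∀ w → (∀ {v} → v < w → InS* S v → ∃₂ λ a s → IsAtom S a × S s × v ≡ a + s) →
                InS* S w → ∃₂ λ a s → IsAtom S a × S s × w ≡ a + s
    decompose w rec w∈S* with anyUpTo? (λ b → InS*? b ×-dec InS*? (w ∸ b)) w
    ... | yes (b , b<w , b∈S* , (_ , w∸b∈S)) with rec b<w b∈S*
    ...   | a , s , a-atom , s∈S , refl =
      a , s + (w ∸ (a + s)) , a-atom , closed _ _ s∈S w∸b∈S ,
      trans (sym (m+[n∸m]≡n (<⇒≤ b<w))) (+-assoc a s _)
    decompose w rec w∈S* | no no-split = w , 0 , (w∈S* , indecomposable) , zero∈ , sym (+-identityʳ w)
      where
      indecomposable : ¬ (∃ λ a → ∃ λ b → InS* S a × InS* S b × (w ≡ a + b))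
      indecomposable (a , b , a∈S* , b∈S* , refl) =
        no-split (a , m<m+n a (proj₁ b∈S*) , a∈S* , subst (InS* S) (sym (m+n∸m≡n a b)) b∈S*)

  IsApéry : ℕ → ℕ → Set
  IsApéry n w = S w × ¬ (n ≤ w × S (w ∸ n))

  apéry-decomposition : ∀ {n} → 0 < n → ∀ x → S x → ∃₂ λ w j → IsApéry n w × x ≡ j * n + w
  apéry-decomposition {n} 0<n = <-rec _ reduce
    where
    reduce : ∀ x → (∀ {y} → y < x → S y → ∃₂ λ w j → IsApéry n w × y ≡ j * n + w) →
             S x → ∃₂ λ w j → IsApéry n w × x ≡ j * n + w
    reduce x rec x∈S with n ≤? x ×-dec S? (x ∸ n)
    ... | no stop = x , 0 , (x∈S , stop) , refl
    ... | yes (n≤x , x∸n∈S) with rec (∸-monoʳ-< 0<n n≤x) x∸n∈S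
    ...   | w , j , w-apéry , eq = w , suc j , w-apéry , (begin
      x               ≡⟨ sym (m+[n∸m]≡n n≤x) ⟩
      n + (x ∸ n)     ≡⟨ cong (n +_) eq ⟩
      n + (j * n + w) ≡⟨ sym (+-assoc n (j * n) w) ⟩
      suc j * n + w   ∎)
      where open ≡-Reasoning

  module _ {m} (mult : IsMultiplicity S m) where

    multiplicity-≤ : ∀ {x} → InS* S x → m ≤ x
    multiplicity-≤ x∈S* with atom-decomposition _ x∈S*
    ... | a , s , a-atom , _ , refl = ≤-trans (proj₂ mult a a-atom) (m≤m+n a s)

    module _ {f} (frob : IsFrobenius S f) where

      apéry-split : ∀ {w} → IsApéry m w → 0 < w →
        ∃₂ λ a s → IsAtom S a × a ≢ m × S s × s ≤ f × w ≡ a + s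
      apéry-split {w} (w∈S , w-apéry) 0<w with atom-decomposition w (0<w , w∈S)
      ... | a , s , a-atom , s∈S , refl = a , s , a-atom , a≢m , s∈S , s≤f , refl
        where
        m≤a+s : m ≤ a + s
        m≤a+s = multiplicity-≤ (0<w , w∈S)
        a≢m : a ≢ m
        a≢m refl = w-apéry (m≤a+s , subst S (sym (m+n∸m≡n m s)) s∈S)
        m<a : m < a
        m<a = ≤∧≢⇒< (proj₂ mult a a-atom) (λ m≡a → a≢m (sym m≡a))
        s<a+s∸m : s < a + s ∸ m
        s<a+s∸m = subst (s <_) (sym (+-∸-comm s (<⇒≤ m<a))) (m<n+m s (m<n⇒0<n∸m m<a))
        s≤f : s ≤ f
        s≤f = <⇒≤ (<-≤-trans s<a+s∸m
          (proj₂ frob _ (≤-<-trans z≤n s<a+s∸m , λ a+s∸m∈S → w-apéry (m≤a+s , a+s∸m∈S))))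

      >frobenius⇒∈ : ∀ {x} → f < x → S x
      >frobenius⇒∈ {x} f<x with S? x
      ... | yes x∈S = x∈S
      ... | no x∉S = contradiction (proj₂ frob x (≤-<-trans z≤n f<x , x∉S)) (<⇒≱ f<x)

      module _ {g e} (gen : IsGenus S g) (edim : IsEmbeddingDimension S e) where

        atoms : List ℕ
        atoms = proj₁ edim

        atom⇒∈atoms : ∀ {a} → IsAtom S a → a ∈ atoms
        atom⇒∈atoms {a} = Equivalence.from (proj₁ (proj₂ (proj₂ edim)) a)

        otherAtoms : List ℕ
        otherAtoms = filter (λ a → ¬? (a ≟ m)) atoms

        smallElements : List ℕ
        smallElements = filter S? (upTo (suc f))

        length-otherAtoms : length otherAtoms ≤ e ∸ 1
        length-otherAtoms = ∸-monoˡ-≤ 1 (begin-strict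
          length otherAtoms <⟨ filter-notAll (λ a → ¬? (a ≟ m)) atoms m-filteredOut ⟩
          length atoms      ≡⟨ proj₂ (proj₂ (proj₂ edim)) ⟩
          e                 ∎)
          where
          open ≤-Reasoning
          m-filteredOut : Any.Any (λ a → ¬ a ≢ m) atoms
          m-filteredOut = Any.map (λ a≡m a≢m → a≢m (sym a≡m)) (atom⇒∈atoms (proj₁ mult))

        length-smallElements : length smallElements ≤ suc f ∸ g
        length-smallElements = begin
          length smallElements                        ≤⟨ m≤m+n _ _ ⟩
          length smallElements + (length gaps ∸ g)    ≡⟨ sym (+-∸-assoc _ g≤gaps) ⟩
          length smallElements + length gaps ∸ g      ≡⟨ cong (_∸ g) partition ⟩
          suc f ∸ g                                   ∎
          where
          open ≤-Reasoning
          gaps : List ℕ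
          gaps = filter (∁? S?) (upTo (suc f))
          g≤gaps : g ≤ length gaps
          g≤gaps = subst (_≤ length gaps) (proj₂ (proj₂ (proj₂ gen)))
            (injection-length-≤ _≟_ (λ x → x) (proj₁ gen) gaps (proj₁ (proj₂ gen)) (λ _ _ eq → eq)
              (λ {x} x∈gen → let gap = Equivalence.to (proj₁ (proj₂ (proj₂ gen)) x) x∈gen in
                ∈-filter⁺ (∁? S?) (∈-upTo⁺ (s≤s (proj₂ frob x gap))) (proj₂ gap)))
          partition : length smallElements + length gaps ≡ suc f
          partition = trans (length-filter-+-length-filter-∁ S? (upTo (suc f))) (length-upTo (suc f))

        sums : List ℕ
        sums = 0 ∷ cartesianProductWith _+_ otherAtoms smallElements

        apéry∈sums : ∀ {w} → IsApéry m w → w ∈ sums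
        apéry∈sums {zero} _ = here refl
        apéry∈sums {suc w} w-apéry with apéry-split w-apéry z<s
        ... | a , s , a-atom , a≢m , s∈S , s≤f , eq =
          there (subst (_∈ cartesianProductWith _+_ otherAtoms smallElements) (sym eq)
            (∈-cartesianProductWith⁺ _+_ a∈otherAtoms s∈smallElements))
          where
          a∈otherAtoms : a ∈ otherAtoms
          a∈otherAtoms = ∈-filter⁺ (λ a → ¬? (a ≟ m)) (atom⇒∈atoms a-atom) a≢m
          s∈smallElements : s ∈ smallElements
          s∈smallElements = ∈-filter⁺ S? (∈-upTo⁺ (s≤s s≤f)) s∈S

        reduceAboveFrobenius : ∀ i → ∃₂ λ w j → IsApéry m w × suc f + i ≡ j * m + w
        reduceAboveFrobenius i =
          apéry-decomposition (proj₁ (proj₁ (proj₁ mult))) (suc f + i) (>frobenius⇒∈ (s≤s (m≤m+n f i)))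

        apéry : ℕ → ℕ
        apéry i = proj₁ (reduceAboveFrobenius i)

        apéry-injective : ∀ {i i′} → i < m → i′ < m → apéry i ≡ apéry i′ → i ≡ i′
        apéry-injective {i} {i′} i<m i′<m same with reduceAboveFrobenius i | reduceAboveFrobenius i′
        ... | w , j , _ , eq | w′ , j′ , _ , eq′ =
          remainder-unique {w = w} {j} {j′} i<m i′<m (sym eq) (trans (cong (j′ * m +_) same) (sym eq′))

        multiplicity-≤-length-sums : m ≤ length sums
        multiplicity-≤-length-sums = subst (_≤ length sums) (length-upTo m)
          (injection-length-≤ _≟_ apéry (upTo m) sums (upTo⁺ m)
            (λ i∈ i′∈ → apéry-injective (∈-upTo⁻ i∈) (∈-upTo⁻ i′∈))
            (λ {i} _ → apéry∈sums (proj₁ (proj₂ (proj₂ (reduceAboveFrobenius i))))))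

        embeddingDimension-frobenius-genus-bound : (e ∸ 1) * (suc f ∸ g) ≥ m ∸ 1
        embeddingDimension-frobenius-genus-bound = begin
          m ∸ 1
            ≤⟨ ∸-monoˡ-≤ 1 multiplicity-≤-length-sums ⟩
          length sums ∸ 1
            ≡⟨ length-cartesianProductWith _+_ otherAtoms smallElements ⟩
          length otherAtoms * length smallElements
            ≤⟨ *-mono-≤ length-otherAtoms length-smallElements ⟩
          (e ∸ 1) * (suc f ∸ g) ∎
          where open ≤-Reasoning

mainTheorem2 : (S : Subsetℕ) → IsNumericalSemigroup S → ProperSubset S →
    (f g e m : ℕ) → IsFrobenius S f → IsGenus S g →
    IsEmbeddingDimension S e → IsMultiplicity S m →
    e ≥ 2 → (e ∸ 1) * (f + 1 ∸ g) ≥ m ∸ 1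
mainTheorem2 S ns _ f g e m frob gen edim mult _ =
  subst (λ n → (e ∸ 1) * (n ∸ g) ≥ m ∸ 1) (+-comm 1 f)
    (decidable-stable (m ∸ 1 ≤? (e ∸ 1) * (suc f ∸ g))
      (¬¬-map (λ S? → DecidableMembership.embeddingDimension-frobenius-genus-bound
                          S ns S? mult frob gen edim)
        (¬¬-decidable-cofinite S (IsNumericalSemigroup.cofinite ns))))
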